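{- The plactic monoid $P_2$ (as a structure in the language of monoids with constants $1,2$) and Presburger arithmetic $(\mathbb{N},0,1,+,\le)$ are bi-interpretable.
   Context: $P_2$ is the monoid presented by generators $1<2$ subject to the Knuth relations $xzy=zxy$ for $x\le y<z$ and $yxz=yzx$ for $x<y\le z$ (i.e. $121=211$ and $212=221$). $\mathbb{N}$ contains $0$. A subset of $\mathcal{M}^m$ is definable in a structure $\mathcal{M}$ if it is the solution set of a first-order formula with parameters from $\mathcal{M}$; a function is definable if its graph is. A structure $\mathcal{N}$ is interpretable in $\mathcal{M}$ if there are $m\in\mathbb{N}$, a definable set $S\subseteq\mathcal{M}^m$ and a bijection $\phi:S\to\mathcal{N}$ such that the preimage under $\phi$ of the equality relation and of the graph of each symbol of the signature of $\mathcal{N}$ is definable in $\mathcal{M}$. Two structures $M_1,M_2$ are bi-interpretable if there is an interpretation of $M_1$ in $M_2$ and one of $M_2$ in $M_1$ such that, for $i=1,2$, the composite map interpreting $M_i$ in itself (obtained by composing the two interpretations) is definable in $M_i$. -}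

module Defs where

open import Data.Nat using (ℕ; zero; suc; _+_; _*_; _≤_)
open import Data.Fin as Fin using (Fin)
open import Data.List using (List; []; _∷_; _++_)
open import Data.Vec as Vec using (Vec; []; _∷_; lookup; tabulate; concat; head)
open import Data.Vec.Relation.Binary.Pointwise.Inductive using (Pointwise; []; _∷_)
open import Data.Product using (Σ; _×_; _,_)
open import Data.Sum using (_⊎_)
open import Data.Empty using (⊥)
open import Relation.Nullary using (¬_)
open import Relation.Binary.Structures using (IsEquivalence)
open import Relation.Binary.PropositionalEquality as P using (_≡_)
open import Function.Bundles using (_⇔_)

-- First-order signatures and structures (equality interpreted by a
-- congruence _≈_, i.e. the structure is the quotient Carrier/≈)

record Signature : Set₁ where
  field
    Fun : ℕ → Set
    Rel : ℕ → Set

record Structure (σ : Signature) : Set₁ where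
  open Signature σ
  field
    Carrier       : Set
    _≈_           : Carrier → Carrier → Set
    isEquivalence : IsEquivalence _≈_
    fun           : ∀ {n} → Fun n → Vec Carrier n → Carrier
    rel           : ∀ {n} → Rel n → Vec Carrier n → Set
    fun-cong      : ∀ {n} (f : Fun n) {xs ys : Vec Carrier n} →
                    Pointwise _≈_ xs ys → fun f xs ≈ fun f ys
    rel-cong      : ∀ {n} (r : Rel n) {xs ys : Vec Carrier n} →
                    Pointwise _≈_ xs ys → rel r xs → rel r ys

-- First-order syntax (de Bruijn variables; variable 0 = innermost)

data Term (σ : Signature) (n : ℕ) : Set where
  var : Fin n → Term σ n
  app : ∀ {k} → Signature.Fun σ k → Vec (Term σ n) k → Term σ n

data Formula (σ : Signature) : ℕ → Set where
  falsum : ∀ {n} → Formula σ n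
  _≐_    : ∀ {n} → Term σ n → Term σ n → Formula σ n
  relF   : ∀ {n k} → Signature.Rel σ k → Vec (Term σ n) k → Formula σ n
  neg    : ∀ {n} → Formula σ n → Formula σ n
  _∧'_   : ∀ {n} → Formula σ n → Formula σ n → Formula σ n
  _∨'_   : ∀ {n} → Formula σ n → Formula σ n → Formula σ n
  _⇒'_   : ∀ {n} → Formula σ n → Formula σ n → Formula σ n
  all    : ∀ {n} → Formula σ (suc n) → Formula σ n
  ex     : ∀ {n} → Formula σ (suc n) → Formula σ n

module _ {σ : Signature} (M : Structure σ) where
  open Structure M

  mutual
    evalT : ∀ {n} → Vec Carrier n → Term σ n → Carrier
    evalT ρ (var i)    = lookup ρ i
    evalT ρ (app f ts) = fun f (evalTs ρ ts)

    evalTs : ∀ {n k} → Vec Carrier n → Vec (Term σ n) k → Vec Carrier k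
    evalTs ρ []       = []
    evalTs ρ (t ∷ ts) = evalT ρ t ∷ evalTs ρ ts

  Sat : ∀ {n} → Formula σ n → Vec Carrier n → Set
  Sat falsum    ρ = ⊥
  Sat (t ≐ u)   ρ = evalT ρ t ≈ evalT ρ u
  Sat (relF r ts) ρ = rel r (evalTs ρ ts)
  Sat (neg φ)   ρ = ¬ Sat φ ρ
  Sat (φ ∧' ψ)  ρ = Sat φ ρ × Sat ψ ρ
  Sat (φ ∨' ψ)  ρ = Sat φ ρ ⊎ Sat ψ ρ
  Sat (φ ⇒' ψ)  ρ = Sat φ ρ → Sat ψ ρ
  Sat (all φ)   ρ = (x : Carrier) → Sat φ (x ∷ ρ)
  Sat (ex φ)    ρ = Σ Carrier λ x → Sat φ (x ∷ ρ)

  Definable : (n : ℕ) → (Vec Carrier n → Set) → Set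
  Definable n P =
    Σ ℕ λ p → Σ (Formula σ (n + p)) λ φ → Σ (Vec Carrier p) λ ps →
      (xs : Vec Carrier n) → P xs ⇔ Sat φ (xs Vec.++ ps)

  DefinableTuples : (m k : ℕ) → (Vec (Vec Carrier m) k → Set) → Set
  DefinableTuples m k P =
    Σ ℕ λ p → Σ (Formula σ (k * m + p)) λ φ → Σ (Vec Carrier p) λ ps →
      (xss : Vec (Vec Carrier m) k) → P xss ⇔ Sat φ (concat xss Vec.++ ps)

record Interpretation {σM σN : Signature}
                      (M : Structure σM) (N : Structure σN) : Set₁ where
  private
    module M = Structure M
    module N = Structure N
  field
    dim    : ℕ
    Dom    : Vec M.Carrier dim → Set
    f      : (xs : Vec M.Carrier dim) → Dom xs → N.Carrier
    f-cong : ∀ {xs ys} (s : Dom xs) (t : Dom ys) →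
             Pointwise M._≈_ xs ys → N._≈_ (f xs s) (f ys t)
    f-inj  : ∀ {xs ys} (s : Dom xs) (t : Dom ys) →
             N._≈_ (f xs s) (f ys t) → Pointwise M._≈_ xs ys
    f-surj : ∀ y → Σ (Vec M.Carrier dim) λ xs → Σ (Dom xs) λ s → N._≈_ (f xs s) y
    Dom-def : DefinableTuples M dim 1 (λ xss → Dom (head xss))
    eq-def  : DefinableTuples M dim 2 (λ xss →
                Σ (Dom (lookup xss Fin.zero)) λ s →
                Σ (Dom (lookup xss (Fin.suc Fin.zero))) λ t →
                  N._≈_ (f _ s) (f _ t))
    -- graph of a function symbol g of arity k: tuples (y, x₁, …, x_k)
    -- with f(y) = g(f(x₁), …, f(x_k))
    fun-def : ∀ {k} (g : Signature.Fun σN k) →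
              DefinableTuples M dim (suc k) (λ xss →
                Σ ((i : Fin k) → Dom (lookup (Vec.tail xss) i)) λ ds →
                Σ (Dom (head xss)) λ d →
                  N._≈_ (N.fun g (tabulate λ i → f _ (ds i))) (f _ d))
    rel-def : ∀ {k} (r : Signature.Rel σN k) →
              DefinableTuples M dim k (λ xss →
                Σ ((i : Fin k) → Dom (lookup xss i)) λ ds →
                  N.rel r (tabulate λ i → f _ (ds i)))

-- Graph of the composite self-interpretation of A obtained from
-- J (B interpreted in A) followed by I (A interpreted in B):
-- (x̄₁,…,x̄_{dim I}, y) with y = f_I(f_J(x̄₁),…,f_J(x̄_{dim I})).
CompositeGraph : ∀ {σA σB} {A : Structure σA} {B : Structure σB} →
                 (J : Interpretation A B) (I : Interpretation B A) →
                 Vec (Vec (Structure.Carrier A) (Interpretation.dim J))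
                     (Interpretation.dim I) →
                 Structure.Carrier A → Set
CompositeGraph {A = A} J I xss y =
  Σ ((i : Fin (Interpretation.dim I)) → Interpretation.Dom J (lookup xss i)) λ ds →
  Σ (Interpretation.Dom I (tabulate λ i → Interpretation.f J _ (ds i))) λ d →
    Structure._≈_ A (Interpretation.f I _ d) y

CompositeDefinable : ∀ {σA σB} {A : Structure σA} {B : Structure σB} →
                     (J : Interpretation A B) (I : Interpretation B A) → Set
CompositeDefinable {A = A} J I =
  Σ ℕ λ p →
  Σ (Formula _ ((Interpretation.dim I * Interpretation.dim J + 1) + p)) λ φ →
  Σ (Vec (Structure.Carrier A) p) λ ps →
    ∀ xss y → CompositeGraph J I xss y ⇔
              Sat A φ ((concat xss Vec.++ (y ∷ [])) Vec.++ ps)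

BiInterpretable : ∀ {σ₁ σ₂} → Structure σ₁ → Structure σ₂ → Set₁
BiInterpretable M₁ M₂ =
  Σ (Interpretation M₂ M₁) λ I →
  Σ (Interpretation M₁ M₂) λ J →
    CompositeDefinable J I × CompositeDefinable I J

-- The plactic monoid P₂ : words over the alphabet 1 < 2 (Fin 2, with
-- 1 = Fin.zero, 2 = Fin.suc Fin.zero) modulo the congruence generated
-- by the Knuth relations.

Letter : Set
Letter = Fin 2

l1 l2 : Letter
l1 = Fin.zero
l2 = Fin.suc Fin.zero

data Knuth : List Letter → List Letter → Set where
  knuth₁ : ∀ {x y z : Letter} → x Fin.≤ y → y Fin.< z →
           Knuth (x ∷ z ∷ y ∷ []) (z ∷ x ∷ y ∷ [])
  knuth₂ : ∀ {x y z : Letter} → x Fin.< y → y Fin.≤ z →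
           Knuth (y ∷ x ∷ z ∷ []) (y ∷ z ∷ x ∷ [])

data _∼_ : List Letter → List Letter → Set where
  base    : ∀ {u v} → Knuth u v → u ∼ v
  ∼-refl  : ∀ {u} → u ∼ u
  ∼-sym   : ∀ {u v} → u ∼ v → v ∼ u
  ∼-trans : ∀ {u v w} → u ∼ v → v ∼ w → u ∼ w
  ++-cong : ∀ {u u' v v'} → u ∼ u' → v ∼ v' → (u ++ v) ∼ (u' ++ v')

data MonFun : ℕ → Set where
  mul   : MonFun 2
  unit  : MonFun 0
  one   : MonFun 0
  two   : MonFun 0

data NoRel : ℕ → Set where

MonoidSig : Signature
MonoidSig = record { Fun = MonFun ; Rel = NoRel }

P₂ : Structure MonoidSig
P₂ = record
  { Carrier = List Letter
  ; _≈_ = _∼_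
  ; isEquivalence = record { refl = ∼-refl ; sym = ∼-sym ; trans = ∼-trans }
  ; fun = funP
  ; rel = λ ()
  ; fun-cong = congP
  ; rel-cong = λ ()
  }
  where
  funP : ∀ {n} → MonFun n → Vec (List Letter) n → List Letter
  funP mul (u ∷ v ∷ []) = u ++ v
  funP unit [] = []
  funP one  [] = l1 ∷ []
  funP two  [] = l2 ∷ []
  congP : ∀ {n} (f : MonFun n) {xs ys} → Pointwise _∼_ xs ys → funP f xs ∼ funP f ys
  congP mul (p ∷ q ∷ []) = ++-cong p q
  congP unit [] = ∼-refl
  congP one  [] = ∼-refl
  congP two  [] = ∼-refl

data PresFun : ℕ → Set where
  zeroF : PresFun 0
  oneF  : PresFun 0
  plus  : PresFun 2

data PresRel : ℕ → Set where
  leq : PresRel 2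

PresburgerSig : Signature
PresburgerSig = record { Fun = PresFun ; Rel = PresRel }

Presburger : Structure PresburgerSig
Presburger = record
  { Carrier = ℕ
  ; _≈_ = _≡_
  ; isEquivalence = P.isEquivalence
  ; fun = funN
  ; rel = relN
  ; fun-cong = congN
  ; rel-cong = rcongN
  }
  where
  funN : ∀ {n} → PresFun n → Vec ℕ n → ℕ
  funN zeroF [] = 0
  funN oneF  [] = 1
  funN plus (a ∷ b ∷ []) = a + b
  relN : ∀ {n} → PresRel n → Vec ℕ n → Set
  relN leq (a ∷ b ∷ []) = a ≤ b
  congN : ∀ {n} (f : PresFun n) {xs ys} → Pointwise _≡_ xs ys → funN f xs ≡ funN f ys
  congN zeroF [] = P.refl
  congN oneF  [] = P.refl
  congN plus (P.refl ∷ P.refl ∷ []) = P.refl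
  rcongN : ∀ {n} (r : PresRel n) {xs ys} → Pointwise _≡_ xs ys → relN r xs → relN r ys
  rcongN leq (P.refl ∷ P.refl ∷ []) h = h

-- Schensted insertion puts every element of P₂ in a unique normal form: the reading word
-- 2^c 1^(c+d) 2^b of a two-row tableau, equal in P₂ to (21)^c 1^d 2^b with 21 central.
-- So P₂ is coded in Presburger arithmetic by triples (c, d, b), multiplication being definable
-- by a case split on whether the twos of the left factor outnumber the ones of the right one.
-- Conversely ℕ is coded in P₂ by the powers of 1 (the elements with no factor 2), with addition
-- as concatenation. The centre of P₂ consists of the powers of 21, so 2^k is definable from 1^k
-- as the power of 2 whose product with 1^k is central; this makes the reading word
-- 2^k₁ 1^k₁ 1^k₂ 2^k₃ definable from the codes of k₁, k₂, k₃, while the other composite is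
-- just (0, d, 0) ↦ d.

module Submission where

open import Defs
open import Data.Nat using (ℕ; zero; suc; _+_; _≤_; z≤n; s≤s)
open import Data.Nat.Properties
  using (+-suc; +-identityʳ; +-comm; +-assoc; +-cancelˡ-≡; 1+n≢n; ≤-total; m≤n⇒∃[o]m+o≡n; m≤m+n)
open import Data.Fin as Fin using (Fin; #_)
open import Data.List using (List; []; _∷_; _++_; [_]; replicate)
open import Data.List.Properties using (++-assoc; ++-identityʳ)
open import Data.Product using (∃; ∃₂; _×_; _,_; map₂)
open import Data.Sum using (_⊎_; inj₁; inj₂)
open import Data.Vec using (Vec; []; _∷_; head)
open import Data.Vec.Relation.Binary.Pointwise.Inductive using (Pointwise; []; _∷_)
open import Relation.Binary.Bundles using (Setoid)
open import Relation.Binary.PropositionalEquality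
  using (_≡_; refl; sym; trans; cong; cong₂; subst; module ≡-Reasoning)
open import Relation.Nullary using (¬_)
open import Data.Empty using (⊥-elim)
open import Function.Bundles using (_⇔_; mk⇔; module Equivalence)
open Equivalence using (to; from)
open import Function.Properties.Equivalence
  using () renaming (refl to ⇔-refl; sym to ⇔-sym; trans to ⇔-trans)
open import Data.Product.Function.NonDependent.Propositional using (_×-⇔_)
open import Data.Unit using (⊤; tt)
import Relation.Binary.Reasoning.Setoid

pattern 𝟙 = Fin.zero
pattern 𝟚 = Fin.suc Fin.zero

∃[r]m≡n+r⊎n≡m+r : ∀ m n → (∃ λ r → m ≡ n + r) ⊎ (∃ λ r → n ≡ m + r)
∃[r]m≡n+r⊎n≡m+r m n with ≤-total n m
... | inj₁ n≤m = inj₁ (map₂ sym (m≤n⇒∃[o]m+o≡n n≤m))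
... | inj₂ m≤n = inj₂ (map₂ sym (m≤n⇒∃[o]m+o≡n m≤n))

inhabited-×-⇔ : ∀ {W A B : Set} → W → A ⇔ B → (W × A) ⇔ B
inhabited-×-⇔ w e = mk⇔ (λ (_ , a) → to e a) (λ b → w , from e b)

≡⇔≡ : ∀ {A : Set} {a a′ b b′ : A} → a ≡ a′ → b ≡ b′ → (a ≡ b) ⇔ (a′ ≡ b′)
≡⇔≡ refl refl = ⇔-refl

infixl 8 _^_

_^_ : Letter → ℕ → List Letter
x ^ n = replicate n x

^-shift : ∀ x n w → x ^ n ++ x ∷ w ≡ x ∷ x ^ n ++ w
^-shift x zero    w = refl
^-shift x (suc n) w = cong (x ∷_) (^-shift x n w)

∼-setoid : Setoid _ _
∼-setoid = record { isEquivalence = Structure.isEquivalence P₂ }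

module ∼-Reasoning = Relation.Binary.Reasoning.Setoid ∼-setoid

≡⇒∼ : ∀ {u v} → u ≡ v → u ∼ v
≡⇒∼ refl = ∼-refl

∼-++ˡ : ∀ p {u v} → u ∼ v → (p ++ u) ∼ (p ++ v)
∼-++ˡ p = ++-cong ∼-refl

∼-++ʳ : ∀ p {u v} → u ∼ v → (u ++ p) ∼ (v ++ p)
∼-++ʳ p q = ++-cong q ∼-refl

21-central-letter : ∀ x → (x ∷ 𝟚 ∷ 𝟙 ∷ []) ∼ (𝟚 ∷ 𝟙 ∷ x ∷ [])
21-central-letter 𝟙 = base (knuth₁ z≤n (s≤s z≤n))
21-central-letter 𝟚 = ∼-sym (base (knuth₂ (s≤s z≤n) (s≤s z≤n)))

21-central : ∀ u v → (u ++ 𝟚 ∷ 𝟙 ∷ v) ∼ (𝟚 ∷ 𝟙 ∷ u ++ v)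
21-central []      v = ∼-refl
21-central (x ∷ u) v = begin
  x ∷ u ++ 𝟚 ∷ 𝟙 ∷ v                 ≈⟨ ∼-++ˡ (x ∷ []) (21-central u v) ⟩
  (x ∷ 𝟚 ∷ 𝟙 ∷ []) ++ u ++ v         ≈⟨ ∼-++ʳ (u ++ v) (21-central-letter x) ⟩
  𝟚 ∷ 𝟙 ∷ x ∷ u ++ v                 ∎
  where open ∼-Reasoning

-- Two-row tableaux

-- tab c d b has first row 1^(c+d) 2^b and second row 2^c; as an element of P₂ it is (21)^c 1^d 2^b.
-- insert is Schensted row insertion.
record Tableau : Set where
  constructor tab
  field
    pairs ones twos : ℕ
open Tableau

∅ : Tableau
∅ = tab 0 0 0

insert : Letter → Tableau → Tableau
insert 𝟙 (tab c d zero)    = tab c (suc d) zero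
insert 𝟙 (tab c d (suc b)) = tab (suc c) d b
insert 𝟚 (tab c d b)       = tab c d (suc b)

insertWord : List Letter → Tableau → Tableau
insertWord []      t = t
insertWord (x ∷ w) t = insertWord w (insert x t)

tableau : List Letter → Tableau
tableau w = insertWord w ∅

reading : Tableau → List Letter
reading (tab c d b) = 𝟚 ^ c ++ 𝟙 ^ (c + d) ++ 𝟚 ^ b

insertWord-++ : ∀ u v t → insertWord (u ++ v) t ≡ insertWord v (insertWord u t)
insertWord-++ []      v t = refl
insertWord-++ (x ∷ u) v t = insertWord-++ u v (insert x t)

knuth-cases : ∀ {u v} → Knuth u v →
              (u ≡ 𝟙 ∷ 𝟚 ∷ 𝟙 ∷ [] × v ≡ 𝟚 ∷ 𝟙 ∷ 𝟙 ∷ []) ⊎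
              (u ≡ 𝟚 ∷ 𝟙 ∷ 𝟚 ∷ [] × v ≡ 𝟚 ∷ 𝟚 ∷ 𝟙 ∷ [])
knuth-cases (knuth₁ {𝟙} {𝟙} {𝟚} _ _) = inj₁ (refl , refl)
knuth-cases (knuth₁ {_} {𝟙} {𝟙} _ ())
knuth-cases (knuth₁ {_} {𝟚} {𝟙} _ ())
knuth-cases (knuth₁ {_} {𝟚} {𝟚} _ (s≤s ()))
knuth-cases (knuth₁ {𝟚} {𝟙} () _)
knuth-cases (knuth₂ {𝟙} {𝟚} {𝟚} _ _) = inj₂ (refl , refl)
knuth-cases (knuth₂ {_} {𝟚} {𝟙} _ ())
knuth-cases (knuth₂ {𝟙} {𝟙} () _)
knuth-cases (knuth₂ {𝟚} {𝟙} () _)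
knuth-cases (knuth₂ {𝟚} {𝟚} (s≤s ()) _)

insertWord-knuth : ∀ {u v} → Knuth u v → ∀ t → insertWord u t ≡ insertWord v t
insertWord-knuth k t with knuth-cases k
... | inj₂ (refl , refl) = refl
insertWord-knuth k (tab c d zero)    | inj₁ (refl , refl) = refl
insertWord-knuth k (tab c d (suc b)) | inj₁ (refl , refl) = refl

insertWord-∼ : ∀ {u v} → u ∼ v → ∀ t → insertWord u t ≡ insertWord v t
insertWord-∼ (base k)      t = insertWord-knuth k t
insertWord-∼ ∼-refl        t = refl
insertWord-∼ (∼-sym p)     t = sym (insertWord-∼ p t)
insertWord-∼ (∼-trans p q) t = trans (insertWord-∼ p t) (insertWord-∼ q t)
insertWord-∼ (++-cong {u} {u′} {v} {v′} p q) t = begin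
  insertWord (u ++ v) t               ≡⟨ insertWord-++ u v t ⟩
  insertWord v (insertWord u t)       ≡⟨ cong (insertWord v) (insertWord-∼ p t) ⟩
  insertWord v (insertWord u′ t)      ≡⟨ insertWord-∼ q _ ⟩
  insertWord v′ (insertWord u′ t)     ≡⟨ insertWord-++ u′ v′ t ⟨
  insertWord (u′ ++ v′) t             ∎
  where open ≡-Reasoning

reading-++ : ∀ c d b w → reading (tab c d b) ++ w ≡ 𝟚 ^ c ++ 𝟙 ^ (c + d) ++ 𝟚 ^ b ++ w
reading-++ c d b w = begin
  (𝟚 ^ c ++ 𝟙 ^ (c + d) ++ 𝟚 ^ b) ++ w   ≡⟨ ++-assoc (𝟚 ^ c) _ w ⟩
  𝟚 ^ c ++ (𝟙 ^ (c + d) ++ 𝟚 ^ b) ++ w   ≡⟨ cong (𝟚 ^ c ++_) (++-assoc (𝟙 ^ (c + d)) _ w) ⟩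
  𝟚 ^ c ++ 𝟙 ^ (c + d) ++ 𝟚 ^ b ++ w     ∎
  where open ≡-Reasoning

reading-insert : ∀ x t w → (reading t ++ x ∷ w) ∼ (reading (insert x t) ++ w)
reading-insert 𝟚 (tab c d b) w = ≡⇒∼ (begin
  reading (tab c d b) ++ 𝟚 ∷ w
    ≡⟨ reading-++ c d b (𝟚 ∷ w) ⟩
  𝟚 ^ c ++ 𝟙 ^ (c + d) ++ 𝟚 ^ b ++ 𝟚 ∷ w
    ≡⟨ cong (λ z → 𝟚 ^ c ++ 𝟙 ^ (c + d) ++ z) (^-shift 𝟚 b w) ⟩
  𝟚 ^ c ++ 𝟙 ^ (c + d) ++ 𝟚 ∷ 𝟚 ^ b ++ w
    ≡⟨ reading-++ c d (suc b) w ⟨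
  reading (tab c d (suc b)) ++ w
    ∎)
  where open ≡-Reasoning
reading-insert 𝟙 (tab c d zero) w = ≡⇒∼ (begin
  reading (tab c d 0) ++ 𝟙 ∷ w
    ≡⟨ reading-++ c d 0 (𝟙 ∷ w) ⟩
  𝟚 ^ c ++ 𝟙 ^ (c + d) ++ 𝟙 ∷ w
    ≡⟨ cong (𝟚 ^ c ++_) (^-shift 𝟙 (c + d) w) ⟩
  𝟚 ^ c ++ 𝟙 ^ suc (c + d) ++ w
    ≡⟨ cong (λ n → 𝟚 ^ c ++ 𝟙 ^ n ++ w) (+-suc c d) ⟨
  𝟚 ^ c ++ 𝟙 ^ (c + suc d) ++ w
    ≡⟨ reading-++ c (suc d) 0 w ⟨
  reading (tab c (suc d) 0) ++ w
    ∎)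
  where open ≡-Reasoning
reading-insert 𝟙 (tab c d (suc b)) w = begin
  reading (tab c d (suc b)) ++ 𝟙 ∷ w
    ≡⟨ reading-++ c d (suc b) (𝟙 ∷ w) ⟩
  𝟚 ^ c ++ 𝟙 ^ (c + d) ++ 𝟚 ∷ 𝟚 ^ b ++ 𝟙 ∷ w
    ≡⟨ cong (λ z → 𝟚 ^ c ++ 𝟙 ^ (c + d) ++ z) (^-shift 𝟚 b (𝟙 ∷ w)) ⟨
  𝟚 ^ c ++ 𝟙 ^ (c + d) ++ 𝟚 ^ b ++ 𝟚 ∷ 𝟙 ∷ w
    ≈⟨ ∼-++ˡ (𝟚 ^ c) (∼-++ˡ (𝟙 ^ (c + d)) (21-central (𝟚 ^ b) w)) ⟩
  𝟚 ^ c ++ 𝟙 ^ (c + d) ++ 𝟚 ∷ 𝟙 ∷ 𝟚 ^ b ++ w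
    ≈⟨ ∼-++ˡ (𝟚 ^ c) (21-central (𝟙 ^ (c + d)) (𝟚 ^ b ++ w)) ⟩
  𝟚 ^ c ++ 𝟚 ∷ 𝟙 ∷ 𝟙 ^ (c + d) ++ 𝟚 ^ b ++ w
    ≡⟨ ^-shift 𝟚 c _ ⟩
  𝟚 ∷ 𝟚 ^ c ++ 𝟙 ∷ 𝟙 ^ (c + d) ++ 𝟚 ^ b ++ w
    ≡⟨ reading-++ (suc c) d b w ⟨
  reading (tab (suc c) d b) ++ w
    ∎
  where open ∼-Reasoning

reading-insertWord : ∀ t w → (reading t ++ w) ∼ reading (insertWord w t)
reading-insertWord t []      = ≡⇒∼ (++-identityʳ (reading t))
reading-insertWord t (x ∷ w) = ∼-trans (reading-insert x t w) (reading-insertWord (insert x t) w)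

∼-reading-tableau : ∀ w → w ∼ reading (tableau w)
∼-reading-tableau = reading-insertWord ∅

insertWord-twos : ∀ n c d b → insertWord (𝟚 ^ n) (tab c d b) ≡ tab c d (b + n)
insertWord-twos zero    c d b = cong (tab c d) (sym (+-identityʳ b))
insertWord-twos (suc n) c d b = trans (insertWord-twos n c d (suc b)) (cong (tab c d) (sym (+-suc b n)))

insertWord-ones-no-bump : ∀ n c d → insertWord (𝟙 ^ n) (tab c d 0) ≡ tab c (d + n) 0
insertWord-ones-no-bump zero    c d = cong (λ d′ → tab c d′ 0) (sym (+-identityʳ d))
insertWord-ones-no-bump (suc n) c d =
  trans (insertWord-ones-no-bump n c (suc d)) (cong (λ d′ → tab c d′ 0) (sym (+-suc d n)))

insertWord-ones-bump : ∀ n r c d → insertWord (𝟙 ^ n) (tab c d (n + r)) ≡ tab (n + c) d r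
insertWord-ones-bump zero    r c d = refl
insertWord-ones-bump (suc n) r c d =
  trans (insertWord-ones-bump n r (suc c) d) (cong (λ c′ → tab c′ d r) (+-suc n c))

insertWord-ones-overflow : ∀ b r c d → insertWord (𝟙 ^ (b + r)) (tab c d b) ≡ tab (b + c) (d + r) 0
insertWord-ones-overflow zero    r c d = insertWord-ones-no-bump r c d
insertWord-ones-overflow (suc b) r c d =
  trans (insertWord-ones-overflow b r (suc c) d) (cong (λ c′ → tab c′ (d + r) 0) (+-suc b c))

infixl 7 _⋆_

_⋆_ : Tableau → Tableau → Tableau
t ⋆ u = insertWord (reading u) t

tableau-++ : ∀ u v → tableau (u ++ v) ≡ tableau u ⋆ tableau v
tableau-++ u v = trans (insertWord-++ u v ∅) (insertWord-∼ (∼-reading-tableau v) (tableau u))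

⋆-unfold : ∀ c₁ d₁ b₁ c₂ d₂ b₂ →
           tab c₁ d₁ b₁ ⋆ tab c₂ d₂ b₂ ≡
           insertWord (𝟚 ^ b₂) (insertWord (𝟙 ^ (c₂ + d₂)) (tab c₁ d₁ (b₁ + c₂)))
⋆-unfold c₁ d₁ b₁ c₂ d₂ b₂ = begin
  insertWord (𝟚 ^ c₂ ++ 𝟙 ^ (c₂ + d₂) ++ 𝟚 ^ b₂) (tab c₁ d₁ b₁)
    ≡⟨ insertWord-++ (𝟚 ^ c₂) _ _ ⟩
  insertWord (𝟙 ^ (c₂ + d₂) ++ 𝟚 ^ b₂) (insertWord (𝟚 ^ c₂) (tab c₁ d₁ b₁))
    ≡⟨ cong (insertWord (𝟙 ^ (c₂ + d₂) ++ 𝟚 ^ b₂)) (insertWord-twos c₂ c₁ d₁ b₁) ⟩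
  insertWord (𝟙 ^ (c₂ + d₂) ++ 𝟚 ^ b₂) (tab c₁ d₁ (b₁ + c₂))
    ≡⟨ insertWord-++ (𝟙 ^ (c₂ + d₂)) _ _ ⟩
  insertWord (𝟚 ^ b₂) (insertWord (𝟙 ^ (c₂ + d₂)) (tab c₁ d₁ (b₁ + c₂)))
    ∎
  where open ≡-Reasoning

-- The twos in the first row of the left factor and the ones of the right factor pair up into new
-- columns; r is what is left over on the larger side.
⋆-twos-surplus : ∀ c₁ d₁ b₁ c₂ d₂ b₂ r → b₁ ≡ d₂ + r →
                 tab c₁ d₁ b₁ ⋆ tab c₂ d₂ b₂ ≡ tab (c₂ + d₂ + c₁) d₁ (r + b₂)
⋆-twos-surplus c₁ d₁ _ c₂ d₂ b₂ r refl = begin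
  tab c₁ d₁ (d₂ + r) ⋆ tab c₂ d₂ b₂
    ≡⟨ ⋆-unfold c₁ d₁ (d₂ + r) c₂ d₂ b₂ ⟩
  insertWord (𝟚 ^ b₂) (insertWord (𝟙 ^ (c₂ + d₂)) (tab c₁ d₁ (d₂ + r + c₂)))
    ≡⟨ cong (λ b → insertWord (𝟚 ^ b₂) (insertWord (𝟙 ^ (c₂ + d₂)) (tab c₁ d₁ b))) twos≡ ⟩
  insertWord (𝟚 ^ b₂) (insertWord (𝟙 ^ (c₂ + d₂)) (tab c₁ d₁ (c₂ + d₂ + r)))
    ≡⟨ cong (insertWord (𝟚 ^ b₂)) (insertWord-ones-bump (c₂ + d₂) r c₁ d₁) ⟩
  insertWord (𝟚 ^ b₂) (tab (c₂ + d₂ + c₁) d₁ r)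
    ≡⟨ insertWord-twos b₂ _ d₁ r ⟩
  tab (c₂ + d₂ + c₁) d₁ (r + b₂)
    ∎
  where
  open ≡-Reasoning
  twos≡ : d₂ + r + c₂ ≡ c₂ + d₂ + r
  twos≡ = trans (+-comm (d₂ + r) c₂) (sym (+-assoc c₂ d₂ r))

⋆-ones-surplus : ∀ c₁ d₁ b₁ c₂ d₂ b₂ r → d₂ ≡ b₁ + r →
                 tab c₁ d₁ b₁ ⋆ tab c₂ d₂ b₂ ≡ tab (b₁ + c₂ + c₁) (d₁ + r) b₂
⋆-ones-surplus c₁ d₁ b₁ c₂ _ b₂ r refl = begin
  tab c₁ d₁ b₁ ⋆ tab c₂ (b₁ + r) b₂
    ≡⟨ ⋆-unfold c₁ d₁ b₁ c₂ (b₁ + r) b₂ ⟩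
  insertWord (𝟚 ^ b₂) (insertWord (𝟙 ^ (c₂ + (b₁ + r))) (tab c₁ d₁ (b₁ + c₂)))
    ≡⟨ cong (λ n → insertWord (𝟚 ^ b₂) (insertWord (𝟙 ^ n) (tab c₁ d₁ (b₁ + c₂)))) ones≡ ⟩
  insertWord (𝟚 ^ b₂) (insertWord (𝟙 ^ (b₁ + c₂ + r)) (tab c₁ d₁ (b₁ + c₂)))
    ≡⟨ cong (insertWord (𝟚 ^ b₂)) (insertWord-ones-overflow (b₁ + c₂) r c₁ d₁) ⟩
  insertWord (𝟚 ^ b₂) (tab (b₁ + c₂ + c₁) (d₁ + r) 0)
    ≡⟨ insertWord-twos b₂ _ _ 0 ⟩
  tab (b₁ + c₂ + c₁) (d₁ + r) b₂
    ∎
  where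
  open ≡-Reasoning
  ones≡ : c₂ + (b₁ + r) ≡ b₁ + c₂ + r
  ones≡ = trans (sym (+-assoc c₂ b₁ r)) (cong (_+ r) (+-comm c₂ b₁))

tableau-ones : ∀ n → tableau (𝟙 ^ n) ≡ tab 0 n 0
tableau-ones n = insertWord-ones-no-bump n 0 0

tableau-twos : ∀ n → tableau (𝟚 ^ n) ≡ tab 0 0 n
tableau-twos n = insertWord-twos n 0 0 0

tableau-reading : ∀ t → tableau (reading t) ≡ t
tableau-reading (tab c d b) = trans (⋆-ones-surplus 0 0 0 c d b d refl) (cong (λ c′ → tab c′ d b) (+-identityʳ c))

∼⇔tableau-≡ : ∀ u v → (u ∼ v) ⇔ (tableau u ≡ tableau v)
∼⇔tableau-≡ u v = mk⇔ (λ p → insertWord-∼ p ∅) λ e → begin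
  u                   ≈⟨ ∼-reading-tableau u ⟩
  reading (tableau u) ≡⟨ cong reading e ⟩
  reading (tableau v) ≈⟨ ∼-reading-tableau v ⟨
  v                   ∎
  where open ∼-Reasoning

∼-reading⇔ : ∀ w t → (w ∼ reading t) ⇔ (tableau w ≡ t)
∼-reading⇔ w t = ⇔-trans (∼⇔tableau-≡ w (reading t)) (≡⇔≡ refl (tableau-reading t))

reading-∼⇔ : ∀ t u → (reading t ∼ reading u) ⇔ (t ≡ u)
reading-∼⇔ t u = ⇔-trans (∼-reading⇔ (reading t) u) (≡⇔≡ (tableau-reading t) refl)

reading-⋆ : ∀ t u v → ((reading t ++ reading u) ∼ reading v) ⇔ (t ⋆ u ≡ v)
reading-⋆ t u v = ⇔-trans (∼-reading⇔ (reading t ++ reading u) v) (≡⇔≡ tableau≡ refl)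
  where
  tableau≡ : tableau (reading t ++ reading u) ≡ t ⋆ u
  tableau≡ = trans (tableau-++ (reading t) (reading u)) (cong₂ _⋆_ (tableau-reading t) (tableau-reading u))

≡⇔components : ∀ {t u} → (t ≡ u) ⇔ ((pairs t ≡ pairs u × ones t ≡ ones u) × twos t ≡ twos u)
≡⇔components = mk⇔ (λ e → (cong pairs e , cong ones e) , cong twos e) λ { ((refl , refl) , refl) → refl }

-- P₂ interpreted in Presburger arithmetic

infixl 25 _⊕_

_⊕_ : ∀ {n} → Term PresburgerSig n → Term PresburgerSig n → Term PresburgerSig n
s ⊕ t = app plus (s ∷ t ∷ [])

0ᵀ 1ᵀ : ∀ {n} → Term PresburgerSig n
0ᵀ = app zeroF []
1ᵀ = app oneF []

infix 5 _≐³_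

_≐³_ : ∀ {n} → Vec (Term PresburgerSig n) 3 → Vec (Term PresburgerSig n) 3 → Formula PresburgerSig n
(s₀ ∷ s₁ ∷ s₂ ∷ []) ≐³ (t₀ ∷ t₁ ∷ t₂ ∷ []) = ((s₀ ≐ t₀) ∧' (s₁ ≐ t₁)) ∧' (s₂ ≐ t₂)

toTab : Vec ℕ 3 → Tableau
toTab (c ∷ d ∷ b ∷ []) = tab c d b

toTab-injective : ∀ {xs ys} → toTab xs ≡ toTab ys → Pointwise _≡_ xs ys
toTab-injective {_ ∷ _ ∷ _ ∷ []} {_ ∷ _ ∷ _ ∷ []} refl = refl ∷ refl ∷ refl ∷ []

-- variable 0 is the surplus r, variables 1–3 the product, 4–6 and 7–9 the two factors
⋆-graphF : Formula PresburgerSig 9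
⋆-graphF = ex (((var (# 6) ≐ var (# 8) ⊕ var (# 0))
                  ∧' ((var (# 7) ⊕ var (# 8) ⊕ var (# 4) ∷ var (# 5) ∷ var (# 0) ⊕ var (# 9) ∷ [])
                        ≐³ (var (# 1) ∷ var (# 2) ∷ var (# 3) ∷ [])))
            ∨' ((var (# 8) ≐ var (# 6) ⊕ var (# 0))
                  ∧' ((var (# 6) ⊕ var (# 7) ⊕ var (# 4) ∷ var (# 5) ⊕ var (# 0) ∷ var (# 9) ∷ [])
                        ≐³ (var (# 1) ∷ var (# 2) ∷ var (# 3) ∷ []))))

⋆-graph : ∀ c₁ d₁ b₁ c₂ d₂ b₂ y₀ y₁ y₂ →
          (tab c₁ d₁ b₁ ⋆ tab c₂ d₂ b₂ ≡ tab y₀ y₁ y₂) ⇔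
          Sat Presburger ⋆-graphF (y₀ ∷ y₁ ∷ y₂ ∷ c₁ ∷ d₁ ∷ b₁ ∷ c₂ ∷ d₂ ∷ b₂ ∷ [])
⋆-graph c₁ d₁ b₁ c₂ d₂ b₂ y₀ y₁ y₂ = mk⇔ graph⇒ graph⇐
  where
  graph⇒ : tab c₁ d₁ b₁ ⋆ tab c₂ d₂ b₂ ≡ tab y₀ y₁ y₂ →
           Sat Presburger ⋆-graphF (y₀ ∷ y₁ ∷ y₂ ∷ c₁ ∷ d₁ ∷ b₁ ∷ c₂ ∷ d₂ ∷ b₂ ∷ [])
  graph⇒ p with ∃[r]m≡n+r⊎n≡m+r b₁ d₂
  ... | inj₁ (r , e) = r , inj₁ (e , to ≡⇔components (trans (sym (⋆-twos-surplus c₁ d₁ b₁ c₂ d₂ b₂ r e)) p))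
  ... | inj₂ (r , e) = r , inj₂ (e , to ≡⇔components (trans (sym (⋆-ones-surplus c₁ d₁ b₁ c₂ d₂ b₂ r e)) p))
  graph⇐ : Sat Presburger ⋆-graphF (y₀ ∷ y₁ ∷ y₂ ∷ c₁ ∷ d₁ ∷ b₁ ∷ c₂ ∷ d₂ ∷ b₂ ∷ []) →
           tab c₁ d₁ b₁ ⋆ tab c₂ d₂ b₂ ≡ tab y₀ y₁ y₂
  graph⇐ (r , inj₁ (e , q)) = trans (⋆-twos-surplus c₁ d₁ b₁ c₂ d₂ b₂ r e) (from ≡⇔components q)
  graph⇐ (r , inj₂ (e , q)) = trans (⋆-ones-surplus c₁ d₁ b₁ c₂ d₂ b₂ r e) (from ≡⇔components q)

constant-graph : ∀ w y₀ y₁ y₂ →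
             ((Fin 0 → ⊤) × ⊤ × (w ∼ reading (tab y₀ y₁ y₂))) ⇔
             ((pairs (tableau w) ≡ y₀ × ones (tableau w) ≡ y₁) × twos (tableau w) ≡ y₂)
constant-graph w _ _ _ = inhabited-×-⇔ (λ ()) (inhabited-×-⇔ tt (⇔-trans (∼-reading⇔ w _) ≡⇔components))

presburger-interprets-P₂ : Interpretation Presburger P₂
presburger-interprets-P₂ = record
  { dim     = 3
  ; Dom     = λ _ → ⊤
  ; f       = λ xs _ → reading (toTab xs)
  ; f-cong  = λ { _ _ (refl ∷ refl ∷ refl ∷ []) → ∼-refl }
  ; f-inj   = λ {xs} {ys} _ _ p → toTab-injective (to (reading-∼⇔ (toTab xs) (toTab ys)) p)
  ; f-surj  = λ w → (pairs (tableau w) ∷ ones (tableau w) ∷ twos (tableau w) ∷ []) , tt ,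
                    ∼-sym (∼-reading-tableau w)
  ; Dom-def = 0 , neg falsum , [] , λ _ → mk⇔ (λ _ ()) (λ _ → tt)
  ; eq-def  = 0 , (var (# 0) ∷ var (# 1) ∷ var (# 2) ∷ []) ≐³ (var (# 3) ∷ var (# 4) ∷ var (# 5) ∷ []) , [] ,
      λ where
        ((x₀ ∷ x₁ ∷ x₂ ∷ []) ∷ (y₀ ∷ y₁ ∷ y₂ ∷ []) ∷ []) →
          inhabited-×-⇔ tt (inhabited-×-⇔ tt
            (⇔-trans (reading-∼⇔ (tab x₀ x₁ x₂) (tab y₀ y₁ y₂)) ≡⇔components))
  ; fun-def = λ where
      mul  → 0 , ⋆-graphF , [] , λ where
        ((y₀ ∷ y₁ ∷ y₂ ∷ []) ∷ (c₁ ∷ d₁ ∷ b₁ ∷ []) ∷ (c₂ ∷ d₂ ∷ b₂ ∷ []) ∷ []) →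
          inhabited-×-⇔ (λ _ → tt) (inhabited-×-⇔ tt
            (⇔-trans (reading-⋆ (tab c₁ d₁ b₁) (tab c₂ d₂ b₂) (tab y₀ y₁ y₂))
                     (⋆-graph c₁ d₁ b₁ c₂ d₂ b₂ y₀ y₁ y₂)))
      unit → 0 , (0ᵀ ∷ 0ᵀ ∷ 0ᵀ ∷ []) ≐³ (var (# 0) ∷ var (# 1) ∷ var (# 2) ∷ []) , [] ,
        λ where ((y₀ ∷ y₁ ∷ y₂ ∷ []) ∷ []) → constant-graph [] y₀ y₁ y₂
      one  → 0 , (0ᵀ ∷ 1ᵀ ∷ 0ᵀ ∷ []) ≐³ (var (# 0) ∷ var (# 1) ∷ var (# 2) ∷ []) , [] ,
        λ where ((y₀ ∷ y₁ ∷ y₂ ∷ []) ∷ []) → constant-graph [ 𝟙 ] y₀ y₁ y₂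
      two  → 0 , (0ᵀ ∷ 0ᵀ ∷ 1ᵀ ∷ []) ≐³ (var (# 0) ∷ var (# 1) ∷ var (# 2) ∷ []) , [] ,
        λ where ((y₀ ∷ y₁ ∷ y₂ ∷ []) ∷ []) → constant-graph [ 𝟚 ] y₀ y₁ y₂
  ; rel-def = λ ()
  }

-- Definable subsets of P₂

infixl 25 _·_

_·_ : ∀ {n} → Term MonoidSig n → Term MonoidSig n → Term MonoidSig n
s · t = app mul (s ∷ t ∷ [])

εᵀ : ∀ {n} → Term MonoidSig n
εᵀ = app unit []

letterᵀ : ∀ {n} → Letter → Term MonoidSig n
letterᵀ 𝟙 = app one []
letterᵀ 𝟚 = app two []

Avoids : Letter → List Letter → Set
Avoids x w = ¬ ∃₂ λ u v → w ∼ (u ++ x ∷ v)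

avoidsF : ∀ {n} → Letter → Fin n → Formula MonoidSig n
avoidsF x i = neg (ex (ex (var (Fin.suc (Fin.suc i)) ≐ var (# 1) · (letterᵀ x · var (# 0)))))

IsCentral : List Letter → Set
IsCentral w = ((w ++ [ 𝟙 ]) ∼ (𝟙 ∷ w)) × ((w ++ [ 𝟚 ]) ∼ (𝟚 ∷ w))

centralF : ∀ {n} → Term MonoidSig n → Formula MonoidSig n
centralF t = (t · letterᵀ 𝟙 ≐ letterᵀ 𝟙 · t) ∧' (t · letterᵀ 𝟚 ≐ letterᵀ 𝟚 · t)

IsPow1 IsPow2 IsPow21 : Tableau → Set
IsPow1  t = pairs t ≡ 0 × twos t ≡ 0
IsPow2  t = pairs t ≡ 0 × ones t ≡ 0
IsPow21 t = twos t ≡ 0 × ones t ≡ 0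

insertWord-preserves : (P : Tableau → Set) → (∀ x t → P t → P (insert x t)) →
                       ∀ w t → P t → P (insertWord w t)
insertWord-preserves P P-insert []      t p = p
insertWord-preserves P P-insert (x ∷ w) t p = insertWord-preserves P P-insert w (insert x t) (P-insert x t p)

¬IsPow1-insert : ∀ x t → ¬ IsPow1 t → ¬ IsPow1 (insert x t)
¬IsPow1-insert 𝟙 (tab c d zero)    p = p
¬IsPow1-insert 𝟙 (tab c d (suc b)) p (() , _)
¬IsPow1-insert 𝟚 t                 p (_ , ())

¬IsPow2-insert : ∀ x t → ¬ IsPow2 t → ¬ IsPow2 (insert x t)
¬IsPow2-insert 𝟙 (tab c d zero)    p (_ , ())
¬IsPow2-insert 𝟙 (tab c d (suc b)) p (() , _)
¬IsPow2-insert 𝟚 t                 p = p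

¬IsPow2-insert-𝟙 : ∀ t → ¬ IsPow2 (insert 𝟙 t)
¬IsPow2-insert-𝟙 (tab c d zero)    (_ , ())
¬IsPow2-insert-𝟙 (tab c d (suc b)) (() , _)

tableau-factor : ∀ u x v → tableau (u ++ x ∷ v) ≡ insertWord v (insert x (tableau u))
tableau-factor u x v = insertWord-++ u (x ∷ v) ∅

avoids-𝟚⇔ : ∀ w → Avoids 𝟚 w ⇔ IsPow1 (tableau w)
avoids-𝟚⇔ w = mk⇔ avoids⇒ avoids⇐
  where
  avoids⇒ : Avoids 𝟚 w → IsPow1 (tableau w)
  avoids⇒ a with tableau w | ∼-reading-tableau w
  ... | tab zero    d zero    | _ = refl , refl
  ... | tab (suc c) d b       | q = ⊥-elim (a ([] , _ , q))
  ... | tab zero    d (suc b) | q = ⊥-elim (a (𝟙 ^ d , 𝟚 ^ b , q))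
  avoids⇐ : IsPow1 (tableau w) → Avoids 𝟚 w
  avoids⇐ p (u , v , q) = insertWord-preserves _ ¬IsPow1-insert v _ (λ { (_ , ()) })
    (subst IsPow1 (trans (insertWord-∼ q ∅) (tableau-factor u 𝟚 v)) p)

avoids-𝟙⇔ : ∀ w → Avoids 𝟙 w ⇔ IsPow2 (tableau w)
avoids-𝟙⇔ w = mk⇔ avoids⇒ avoids⇐
  where
  avoids⇒ : Avoids 𝟙 w → IsPow2 (tableau w)
  avoids⇒ a with tableau w | ∼-reading-tableau w
  ... | tab zero    zero    b | _ = refl , refl
  ... | tab (suc c) d       b | q = ⊥-elim (a (𝟚 ^ suc c , _ , q))
  ... | tab zero    (suc d) b | q = ⊥-elim (a ([] , _ , q))
  avoids⇐ : IsPow2 (tableau w) → Avoids 𝟙 w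
  avoids⇐ p (u , v , q) = insertWord-preserves _ ¬IsPow2-insert v _ (¬IsPow2-insert-𝟙 (tableau u))
    (subst IsPow2 (trans (insertWord-∼ q ∅) (tableau-factor u 𝟙 v)) p)

commutes⇔ : ∀ x w → ((w ++ [ x ]) ∼ (x ∷ w)) ⇔ (insert x (tableau w) ≡ tableau [ x ] ⋆ tableau w)
commutes⇔ x w = ⇔-trans (∼⇔tableau-≡ (w ++ [ x ]) (x ∷ w))
                        (≡⇔≡ (insertWord-++ w [ x ] ∅) (tableau-++ [ x ] w))

insert-𝟙-commutes⇔ : ∀ t → (insert 𝟙 t ≡ tab 0 1 0 ⋆ t) ⇔ (twos t ≡ 0)
insert-𝟙-commutes⇔ (tab c d zero) = mk⇔ (λ _ → refl) λ _ →
  sym (trans (⋆-ones-surplus 0 1 0 c d 0 d refl) (cong (λ c′ → tab c′ (suc d) 0) (+-identityʳ c)))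
insert-𝟙-commutes⇔ (tab c d (suc b)) = mk⇔
  (λ e → ⊥-elim (1+n≢n (sym (cong twos (trans e (⋆-ones-surplus 0 1 0 c d (suc b) d refl))))))
  (λ ())

insert-𝟚-commutes⇔ : ∀ t → (insert 𝟚 t ≡ tab 0 0 1 ⋆ t) ⇔ (ones t ≡ 0)
insert-𝟚-commutes⇔ (tab c zero b) = mk⇔ (λ _ → refl) λ _ →
  sym (trans (⋆-twos-surplus 0 0 1 c 0 b 1 refl)
             (cong (λ c′ → tab c′ 0 (suc b)) (trans (+-identityʳ (c + 0)) (+-identityʳ c))))
insert-𝟚-commutes⇔ (tab c (suc d) b) = mk⇔
  (λ e → ⊥-elim (1+n≢n (cong twos (trans e (⋆-ones-surplus 0 0 1 c (suc d) b d refl)))))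
  (λ ())

central⇔ : ∀ w → IsCentral w ⇔ IsPow21 (tableau w)
central⇔ w = ⇔-trans (commutes⇔ 𝟙 w) (insert-𝟙-commutes⇔ (tableau w))
         ×-⇔ ⇔-trans (commutes⇔ 𝟚 w) (insert-𝟚-commutes⇔ (tableau w))

IsPow1⇒≡ : ∀ {t} → IsPow1 t → t ≡ tab 0 (ones t) 0
IsPow1⇒≡ (refl , refl) = refl

IsPow2⇒≡ : ∀ {t} → IsPow2 t → t ≡ tab 0 0 (twos t)
IsPow2⇒≡ (refl , refl) = refl

⋆-IsPow21⇔ : ∀ j k → IsPow21 (tab 0 0 j ⋆ tab 0 k 0) ⇔ (j ≡ k)
⋆-IsPow21⇔ j k with ∃[r]m≡n+r⊎n≡m+r j k
... | inj₁ (r , j≡k+r) rewrite ⋆-twos-surplus 0 0 j 0 k 0 r j≡k+r | +-identityʳ r = mk⇔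
  (λ { (refl , _) → trans j≡k+r (+-identityʳ k) })
  (λ j≡k → +-cancelˡ-≡ k r 0 (trans (sym j≡k+r) (trans j≡k (sym (+-identityʳ k)))) , refl)
... | inj₂ (r , k≡j+r) rewrite ⋆-ones-surplus 0 0 j 0 k 0 r k≡j+r = mk⇔
  (λ { (_ , refl) → sym (trans k≡j+r (+-identityʳ j)) })
  (λ j≡k → refl , +-cancelˡ-≡ j r 0 (trans (sym k≡j+r) (trans (sym j≡k) (sym (+-identityʳ j)))))

matches⇔ : ∀ p q → IsPow1 (tableau p) →
           (Avoids 𝟙 q × IsCentral (q ++ p)) ⇔ (tableau q ≡ tab 0 0 (ones (tableau p)))
matches⇔ p q p-pow = mk⇔ matches⇒ matches⇐
  where
  tableau-qp : IsPow2 (tableau q) → tableau (q ++ p) ≡ tab 0 0 (twos (tableau q)) ⋆ tab 0 (ones (tableau p)) 0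
  tableau-qp q-pow = trans (tableau-++ q p) (cong₂ _⋆_ (IsPow2⇒≡ q-pow) (IsPow1⇒≡ p-pow))
  matches⇒ : Avoids 𝟙 q × IsCentral (q ++ p) → tableau q ≡ tab 0 0 (ones (tableau p))
  matches⇒ (a , c) = trans (IsPow2⇒≡ q-pow) (cong (tab 0 0) (to (⋆-IsPow21⇔ _ _)
    (subst IsPow21 (tableau-qp q-pow) (to (central⇔ (q ++ p)) c))))
    where q-pow = to (avoids-𝟙⇔ q) a
  matches⇐ : tableau q ≡ tab 0 0 (ones (tableau p)) → Avoids 𝟙 q × IsCentral (q ++ p)
  matches⇐ e = from (avoids-𝟙⇔ q) q-pow , from (central⇔ (q ++ p))
    (subst IsPow21 (sym (tableau-qp q-pow)) (from (⋆-IsPow21⇔ _ _) (cong twos e)))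
    where q-pow = cong pairs e , cong ones e

-- Presburger arithmetic interpreted in P₂

IsPow1-ones : ∀ n → IsPow1 (tableau (𝟙 ^ n))
IsPow1-ones n = subst IsPow1 (sym (tableau-ones n)) (refl , refl)

tab-ones-≡⇔ : ∀ {m n} → (tab 0 m 0 ≡ tab 0 n 0) ⇔ (m ≡ n)
tab-ones-≡⇔ = mk⇔ (cong ones) (cong (λ n → tab 0 n 0))

IsPow1-tableau⇔ : ∀ w n → (IsPow1 (tableau w) × n ≡ ones (tableau w)) ⇔ (tableau w ≡ tab 0 n 0)
IsPow1-tableau⇔ w n = mk⇔
  (λ (p , e) → trans (IsPow1⇒≡ p) (cong (λ m → tab 0 m 0) (sym e)))
  (λ e → subst IsPow1 (sym e) (refl , refl) , cong ones (sym e))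

tableau-pow1-++ : ∀ u v → IsPow1 (tableau u) → IsPow1 (tableau v) →
                  tableau (u ++ v) ≡ tab 0 (ones (tableau u) + ones (tableau v)) 0
tableau-pow1-++ u v p q = begin
  tableau (u ++ v)           ≡⟨ tableau-++ u v ⟩
  tableau u ⋆ tableau v      ≡⟨ cong₂ _⋆_ (IsPow1⇒≡ p) (IsPow1⇒≡ q) ⟩
  tab 0 m 0 ⋆ tab 0 n 0      ≡⟨ ⋆-ones-surplus 0 m 0 0 n 0 n refl ⟩
  tab 0 (m + n) 0            ∎
  where
  open ≡-Reasoning
  m = ones (tableau u)
  n = ones (tableau v)

pow1-word⇔ : ∀ w n → (IsPow1 (tableau w) × n ≡ ones (tableau w)) ⇔ (w ∼ (𝟙 ^ n))
pow1-word⇔ w n = ⇔-trans (IsPow1-tableau⇔ w n)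
                         (⇔-sym (⇔-trans (∼⇔tableau-≡ w (𝟙 ^ n)) (≡⇔≡ refl (tableau-ones n))))

pow1-∼⇔ : ∀ u v → IsPow1 (tableau u) → IsPow1 (tableau v) →
          (u ∼ v) ⇔ (ones (tableau u) ≡ ones (tableau v))
pow1-∼⇔ u v p q = ⇔-trans (∼⇔tableau-≡ u v) (⇔-trans (≡⇔≡ (IsPow1⇒≡ p) (IsPow1⇒≡ q)) tab-ones-≡⇔)

pow1-+⇔ : ∀ u v w → IsPow1 (tableau u) → IsPow1 (tableau v) →
          (w ∼ (u ++ v)) ⇔ (IsPow1 (tableau w) × ones (tableau u) + ones (tableau v) ≡ ones (tableau w))
pow1-+⇔ u v w p q = ⇔-trans (∼⇔tableau-≡ w (u ++ v))
  (⇔-trans (≡⇔≡ refl (tableau-pow1-++ u v p q)) (⇔-sym (IsPow1-tableau⇔ w _)))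

pow1-≤⇔ : ∀ u v → IsPow1 (tableau u) → IsPow1 (tableau v) →
          (∃ λ z → Avoids 𝟚 z × (u ++ z) ∼ v) ⇔ (ones (tableau u) ≤ ones (tableau v))
pow1-≤⇔ u v p q = mk⇔ ∃⇒≤ ≤⇒∃
  where
  ∃⇒≤ : (∃ λ z → Avoids 𝟚 z × (u ++ z) ∼ v) → ones (tableau u) ≤ ones (tableau v)
  ∃⇒≤ (z , a , s) = subst (ones (tableau u) ≤_) (cong ones tableau≡) (m≤m+n _ _)
    where
    tableau≡ : tab 0 (ones (tableau u) + ones (tableau z)) 0 ≡ tableau v
    tableau≡ = trans (sym (tableau-pow1-++ u z p (to (avoids-𝟚⇔ z) a))) (to (∼⇔tableau-≡ (u ++ z) v) s)
  ≤⇒∃ : ones (tableau u) ≤ ones (tableau v) → ∃ λ z → Avoids 𝟚 z × (u ++ z) ∼ v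
  ≤⇒∃ u≤v with m≤n⇒∃[o]m+o≡n u≤v
  ... | k , e = 𝟙 ^ k , from (avoids-𝟚⇔ (𝟙 ^ k)) (IsPow1-ones k) , from (∼⇔tableau-≡ (u ++ 𝟙 ^ k) v) (begin
    tableau (u ++ 𝟙 ^ k)
      ≡⟨ tableau-pow1-++ u (𝟙 ^ k) p (IsPow1-ones k) ⟩
    tab 0 (ones (tableau u) + ones (tableau (𝟙 ^ k))) 0
      ≡⟨ cong (λ t → tab 0 (ones (tableau u) + ones t) 0) (tableau-ones k) ⟩
    tab 0 (ones (tableau u) + k) 0
      ≡⟨ cong (λ n → tab 0 n 0) e ⟩
    tab 0 (ones (tableau v)) 0
      ≡⟨ IsPow1⇒≡ q ⟨
    tableau v
      ∎)
    where open ≡-Reasoning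

P₂-interprets-presburger : Interpretation P₂ Presburger
P₂-interprets-presburger = record
  { dim     = 1
  ; Dom     = λ ws → IsPow1 (tableau (head ws))
  ; f       = λ ws _ → ones (tableau (head ws))
  ; f-cong  = λ { _ _ (p ∷ []) → cong ones (insertWord-∼ p ∅) }
  ; f-inj   = λ { {u ∷ []} {v ∷ []} p q e → from (pow1-∼⇔ u v p q) e ∷ [] }
  ; f-surj  = λ n → (𝟙 ^ n ∷ []) , IsPow1-ones n , cong ones (tableau-ones n)
  ; Dom-def = 0 , avoidsF 𝟚 (# 0) , [] , λ { ((w ∷ []) ∷ []) → ⇔-sym (avoids-𝟚⇔ w) }
  ; eq-def  = 0 , (avoidsF 𝟚 (# 0) ∧' avoidsF 𝟚 (# 1)) ∧' (var (# 0) ≐ var (# 1)) , [] ,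
      λ { ((u ∷ []) ∷ (v ∷ []) ∷ []) → mk⇔
        (λ (p , q , e) → (from (avoids-𝟚⇔ u) p , from (avoids-𝟚⇔ v) q) , from (pow1-∼⇔ u v p q) e)
        (λ ((a , b) , s) → let p = to (avoids-𝟚⇔ u) a ; q = to (avoids-𝟚⇔ v) b in
                           p , q , to (pow1-∼⇔ u v p q) s) }
  ; fun-def = λ where
      zeroF → 0 , var (# 0) ≐ εᵀ , [] ,
        λ { ((w ∷ []) ∷ []) → inhabited-×-⇔ (λ ()) (pow1-word⇔ w 0) }
      oneF  → 0 , var (# 0) ≐ letterᵀ 𝟙 , [] ,
        λ { ((w ∷ []) ∷ []) → inhabited-×-⇔ (λ ()) (pow1-word⇔ w 1) }
      plus  → 0 , (avoidsF 𝟚 (# 1) ∧' avoidsF 𝟚 (# 2)) ∧' (var (# 0) ≐ var (# 1) · var (# 2)) , [] ,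
        λ { ((w ∷ []) ∷ (u ∷ []) ∷ (v ∷ []) ∷ []) → mk⇔
          (λ (ds , r) → (from (avoids-𝟚⇔ u) (ds 𝟙) , from (avoids-𝟚⇔ v) (ds 𝟚)) ,
                        from (pow1-+⇔ u v w (ds 𝟙) (ds 𝟚)) r)
          (λ ((a , b) , s) → let p = to (avoids-𝟚⇔ u) a ; q = to (avoids-𝟚⇔ v) b in
                             (λ { 𝟙 → p ; 𝟚 → q }) , to (pow1-+⇔ u v w p q) s) }
  ; rel-def = λ where
      leq → 0 , (avoidsF 𝟚 (# 0) ∧' avoidsF 𝟚 (# 1))
                  ∧' ex (avoidsF 𝟚 (# 0) ∧' (var (# 1) · var (# 0) ≐ var (# 2))) , [] ,
        λ { ((u ∷ []) ∷ (v ∷ []) ∷ []) → mk⇔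
          (λ (ds , u≤v) → (from (avoids-𝟚⇔ u) (ds 𝟙) , from (avoids-𝟚⇔ v) (ds 𝟚)) ,
                          from (pow1-≤⇔ u v (ds 𝟙) (ds 𝟚)) u≤v)
          (λ ((a , b) , z) → let p = to (avoids-𝟚⇔ u) a ; q = to (avoids-𝟚⇔ v) b in
                             (λ { 𝟙 → p ; 𝟚 → q }) , to (pow1-≤⇔ u v p q) z) }
  }

-- The composite self-interpretations

tableau-factors : ∀ q₁ x₁ x₂ q₃ {k₁ k₂ k₃} →
                  tableau q₁ ≡ tab 0 0 k₁ → tableau x₁ ≡ tab 0 k₁ 0 →
                  tableau x₂ ≡ tab 0 k₂ 0 → tableau q₃ ≡ tab 0 0 k₃ →
                  tableau (q₁ ++ x₁ ++ x₂ ++ q₃) ≡ tab k₁ k₂ k₃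
tableau-factors q₁ x₁ x₂ q₃ {k₁} {k₂} {k₃} e₁ e₂ e₃ e₄ = begin
  tableau (q₁ ++ x₁ ++ x₂ ++ q₃)
    ≡⟨ tableau-++ q₁ _ ⟩
  tableau q₁ ⋆ tableau (x₁ ++ x₂ ++ q₃)
    ≡⟨ cong (tableau q₁ ⋆_) (tableau-++ x₁ _) ⟩
  tableau q₁ ⋆ (tableau x₁ ⋆ tableau (x₂ ++ q₃))
    ≡⟨ cong (λ t → tableau q₁ ⋆ (tableau x₁ ⋆ t)) (tableau-++ x₂ q₃) ⟩
  tableau q₁ ⋆ (tableau x₁ ⋆ (tableau x₂ ⋆ tableau q₃))
    ≡⟨ cong₂ _⋆_ e₁ (cong₂ _⋆_ e₂ (cong₂ _⋆_ e₃ e₄)) ⟩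
  tab 0 0 k₁ ⋆ (tab 0 k₁ 0 ⋆ (tab 0 k₂ 0 ⋆ tab 0 0 k₃))
    ≡⟨ cong (λ t → tab 0 0 k₁ ⋆ (tab 0 k₁ 0 ⋆ t)) (⋆-twos-surplus 0 k₂ 0 0 0 k₃ 0 refl) ⟩
  tab 0 0 k₁ ⋆ (tab 0 k₁ 0 ⋆ tab 0 k₂ k₃)
    ≡⟨ cong (tab 0 0 k₁ ⋆_) (⋆-ones-surplus 0 k₁ 0 0 k₂ k₃ k₂ refl) ⟩
  tab 0 0 k₁ ⋆ tab 0 (k₁ + k₂) k₃
    ≡⟨ ⋆-ones-surplus 0 0 k₁ 0 (k₁ + k₂) k₃ k₂ refl ⟩
  tab (k₁ + 0 + 0) k₂ k₃
    ≡⟨ cong (λ c → tab c k₂ k₃) (trans (+-identityʳ (k₁ + 0)) (+-identityʳ k₁)) ⟩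
  tab k₁ k₂ k₃
    ∎
  where open ≡-Reasoning

reading-factors⇔ : ∀ x₁ x₂ x₃ y → IsPow1 (tableau x₁) → IsPow1 (tableau x₂) → IsPow1 (tableau x₃) →
  (reading (tab (ones (tableau x₁)) (ones (tableau x₂)) (ones (tableau x₃))) ∼ y) ⇔
  (∃₂ λ q₁ q₃ → ((Avoids 𝟙 q₁ × IsCentral (q₁ ++ x₁)) × (Avoids 𝟙 q₃ × IsCentral (q₃ ++ x₃))) ×
                y ∼ (q₁ ++ x₁ ++ x₂ ++ q₃))
reading-factors⇔ x₁ x₂ x₃ y p₁ p₂ p₃ = mk⇔
  (λ e → 𝟚 ^ k₁ , 𝟚 ^ k₃ ,
         (from (matches⇔ x₁ (𝟚 ^ k₁) p₁) (tableau-twos k₁) ,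
          from (matches⇔ x₃ (𝟚 ^ k₃) p₃) (tableau-twos k₃)) ,
         from (∼⇔tableau-≡ y _) (trans (to (∼-reading⇔ y _) (∼-sym e))
           (sym (tableau-factors (𝟚 ^ k₁) x₁ x₂ (𝟚 ^ k₃) (tableau-twos k₁) x₁≡ x₂≡ (tableau-twos k₃)))))
  (λ (q₁ , q₃ , (m₁ , m₃) , s) → ∼-sym (from (∼-reading⇔ y _) (trans (to (∼⇔tableau-≡ y _) s)
           (tableau-factors q₁ x₁ x₂ q₃ (to (matches⇔ x₁ q₁ p₁) m₁) x₁≡ x₂≡
                            (to (matches⇔ x₃ q₃ p₃) m₃)))))
  where
  k₁ = ones (tableau x₁)
  k₃ = ones (tableau x₃)
  x₁≡ = IsPow1⇒≡ p₁
  x₂≡ = IsPow1⇒≡ p₂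

matchesF : ∀ {n} → Fin n → Fin n → Formula MonoidSig n
matchesF i j = avoidsF 𝟙 j ∧' centralF (var j · var i)

-- variables 0–2 are the powers of 1 coding a tableau and 3 is its reading word;
-- the bound variables are the powers of 2 matching variables 0 and 2
readingF : Formula MonoidSig 4
readingF = ((avoidsF 𝟚 (# 0) ∧' avoidsF 𝟚 (# 1)) ∧' avoidsF 𝟚 (# 2)) ∧'
  ex (ex ((matchesF (# 2) (# 1) ∧' matchesF (# 4) (# 0)) ∧'
          (var (# 5) ≐ var (# 1) · (var (# 2) · (var (# 3) · var (# 0))))))

P₂-composite-definable : CompositeDefinable P₂-interprets-presburger presburger-interprets-P₂
P₂-composite-definable = 0 , readingF , [] ,
  λ { ((x₁ ∷ []) ∷ (x₂ ∷ []) ∷ (x₃ ∷ []) ∷ []) y → mk⇔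
    (λ (ds , _ , e) →
       ((from (avoids-𝟚⇔ x₁) (ds 𝟙) , from (avoids-𝟚⇔ x₂) (ds 𝟚)) , from (avoids-𝟚⇔ x₃) (ds (Fin.suc 𝟚))) ,
       to (reading-factors⇔ x₁ x₂ x₃ y (ds 𝟙) (ds 𝟚) (ds (Fin.suc 𝟚))) e)
    (λ (((a₁ , a₂) , a₃) , r) →
       let p₁ = to (avoids-𝟚⇔ x₁) a₁ ; p₂ = to (avoids-𝟚⇔ x₂) a₂ ; p₃ = to (avoids-𝟚⇔ x₃) a₃ in
       (λ { 𝟙 → p₁ ; 𝟚 → p₂ ; (Fin.suc 𝟚) → p₃ }) , tt , from (reading-factors⇔ x₁ x₂ x₃ y p₁ p₂ p₃) r) }

presburger-composite-definable : CompositeDefinable presburger-interprets-P₂ P₂-interprets-presburger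
presburger-composite-definable =
  0 , ((var (# 0) ≐ 0ᵀ) ∧' (var (# 2) ≐ 0ᵀ)) ∧' (var (# 1) ≐ var (# 3)) , [] ,
  λ { ((c ∷ d ∷ b ∷ []) ∷ []) y → inhabited-×-⇔ (λ _ → tt)
      (subst (λ t → (IsPow1 t × ones t ≡ y) ⇔ ((c ≡ 0 × b ≡ 0) × d ≡ y))
             (sym (tableau-reading (tab c d b))) ⇔-refl) }

mainTheorem2 : BiInterpretable P₂ Presburger
mainTheorem2 = presburger-interprets-P₂ , P₂-interprets-presburger ,
               P₂-composite-definable , presburger-composite-definable
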